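{- Let $k\geq 2$ be an integer and let $D=\{\mathbf{v}_1,\mathbf{v}_2,\ldots,\mathbf{v}_m\}\subseteq\mathbb{Z}^2$. Then $D$ is a $\mathrm{DD}(m)$ with maximal $k$-hop coverage if and only if $D$ is a $B_{2k}$ sequence over $\mathbb{Z}^2$.
   Context: A distinct difference configuration $\mathrm{DD}(m)$ is a set $D=\{\mathbf{v}_1,\dots,\mathbf{v}_m\}$ of $m$ points of $\mathbb{Z}^2$ such that the difference vectors $\mathbf{v}_i-\mathbf{v}_j$ ($i\neq j$) are all distinct. The $k$-hop coverage $C_k(D)$ is the number of non-zero vectors of the form $\sum_{i=1}^{\ell}(\mathbf{v}_{\alpha_i}-\mathbf{v}_{\beta_i})$ with $\alpha_i\neq\beta_i$ and $0\le \ell\le k$. For a non-negative integer $j$ let $H_j=\{(a_1,\dots,a_m)\in\mathbb{Z}^m : \sum_i a_i=0,\ \sum_{\{i:a_i>0\}}a_i=j\}$. It is known that $C_k(D)\le\sum_{i=1}^k|H_i|$; $D$ has maximal $k$-hop coverage if $C_k(D)=\sum_{i=1}^k|H_i|$. For an abelian group $A$, a sequence $\mathbf{v}_1,\dots,\mathbf{v}_m$ of elements of $A$ is a $B_h$ sequence over $A$ if all sums $\mathbf{v}_{i_1}+\cdots+\mathbf{v}_{i_h}$ with $1\le i_1\le\cdots\le i_h\le m$ are distinct. -}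

module Defs where

open import Data.Nat as ℕ using (ℕ; zero; suc; _≤_)
open import Data.Integer as ℤ using (ℤ; +_; -[1+_]; _-_; _+_)
import Data.Integer.Properties as ℤP
open import Data.Fin as Fin using (Fin)
import Data.Fin.Properties as FinP
open import Data.Product using (_×_; _,_; ∃-syntax)
open import Data.Product.Properties using (≡-dec)
open import Data.List as List using (List; []; _∷_; map; concat; filter; length; upTo; allFin; cartesianProduct; deduplicate)
import Data.Nat.ListAction
open import Data.Vec as Vec using (Vec; lookup)
open import Relation.Nullary using (¬_; Dec)
open import Relation.Nullary.Decidable using (_×-dec_; ¬?)
open import Relation.Binary.PropositionalEquality using (_≡_; _≢_)

ℤ² : Set
ℤ² = ℤ × ℤ

0² : ℤ²
0² = (+ 0 , + 0)

_⊕_ : ℤ² → ℤ² → ℤ²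
(a , b) ⊕ (c , d) = (a + c , b + d)

_⊖_ : ℤ² → ℤ² → ℤ²
(a , b) ⊖ (c , d) = (a - c , b - d)

_≟²_ : (x y : ℤ²) → Dec (x ≡ y)
_≟²_ = ≡-dec ℤP._≟_ ℤP._≟_

sum² : List ℤ² → ℤ²
sum² = List.foldr _⊕_ 0²

IsDD : ∀ {m} → (Fin m → ℤ²) → Set
IsDD {m} v = ∀ (i j i' j' : Fin m) → i ≢ j → i' ≢ j' →
  v i ⊖ v j ≡ v i' ⊖ v j' → (i ≡ i') × (j ≡ j')

offPairs : (m : ℕ) → List (Fin m × Fin m)
offPairs m = filter (λ p → ¬? (Data.Product.proj₁ p Fin.≟ Data.Product.proj₂ p))
                    (cartesianProduct (allFin m) (allFin m))
  where import Data.Product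

tuples : ∀ {A : Set} → ℕ → List A → List (List A)
tuples zero    xs = [] ∷ []
tuples (suc ℓ) xs = concat (map (λ x → map (x ∷_) (tuples ℓ xs)) xs)

hopSum : ∀ {m} → (Fin m → ℤ²) → List (Fin m × Fin m) → ℤ²
hopSum v ps = sum² (map (λ { (α , β) → v α ⊖ v β }) ps)

hopVectors : ∀ {m} → ℕ → (Fin m → ℤ²) → List ℤ²
hopVectors {m} k v =
  concat (map (λ ℓ → map (hopSum v) (tuples ℓ (offPairs m))) (upTo (suc k)))

coverage : ∀ {m} → ℕ → (Fin m → ℤ²) → ℕ
coverage k v =
  length (deduplicate _≟²_ (filter (λ x → ¬? (x ≟² 0²)) (hopVectors k v)))

pos : ℤ → ℕ
pos (+ n)    = n
pos -[1+ n ] = 0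

sumℤ : ∀ {m} → Vec ℤ m → ℤ
sumℤ = Vec.foldr _ _+_ (+ 0)

posSum : ∀ {m} → Vec ℤ m → ℕ
posSum = Vec.foldr _ (λ a s → pos a ℕ.+ s) 0

rangeℤ : ℕ → List ℤ
rangeℤ j = map (λ n → + n - + j) (upTo (suc (j ℕ.+ j)))

allVecs : (m : ℕ) → List ℤ → List (Vec ℤ m)
allVecs zero    xs = Vec.[] ∷ []
allVecs (suc m) xs = concat (map (λ x → map (x Vec.∷_) (allVecs m xs)) xs)

-- H_j = {a ∈ ℤ^m : ∑ a_i = 0, ∑_{a_i>0} a_i = j}. Every such a has all
-- |a_i| ≤ j, so H_j is exactly the filtered list below (no repetitions).
Hlist : (m j : ℕ) → List (Vec ℤ m)
Hlist m j = filter (λ a → (sumℤ a ℤP.≟ + 0) ×-dec (posSum a ℕ.≟ j)) (allVecs m (rangeℤ j))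

Hcard : (m j : ℕ) → ℕ
Hcard m j = length (Hlist m j)

Hsum : (m k : ℕ) → ℕ
Hsum m k = Data.Nat.ListAction.sum (map (λ i → Hcard m (suc i)) (upTo k))

MaximalCoverage : ∀ {m} → ℕ → (Fin m → ℤ²) → Set
MaximalCoverage {m} k v = coverage k v ≡ Hsum m k

NonDecr : ∀ {m h} → Vec (Fin m) h → Set
NonDecr {h = h} s = ∀ (a b : Fin h) → a Fin.≤ b → lookup s a Fin.≤ lookup s b

indexSum : ∀ {m h} → (Fin m → ℤ²) → Vec (Fin m) h → ℤ²
indexSum v s = Vec.foldr _ (λ i acc → v i ⊕ acc) 0² s

IsBh : ∀ {m} → ℕ → (Fin m → ℤ²) → Set
IsBh {m} h v = ∀ (s t : Vec (Fin m) h) → NonDecr s → NonDecr t →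
  indexSum v s ≡ indexSum v t → s ≡ t

-- Write vᵢ for the points of D and ⟨a⟩ = ∑ aᵢvᵢ for a ∈ ℤᵐ. Call a balanced if ∑ aᵢ = 0, and call the sum of its
-- positive entries its height, so that H_j is the set of balanced vectors of height j. The ℓ-hop sums, ℓ ≤ k, are
-- exactly the ⟨a⟩ with a ∈ H_0 ∪ ⋯ ∪ H_k (pair the positive with the negative entries of a), so C_k(D), which counts
-- the nonzero ones, equals ∑_{i ≤ k} |H_i| iff a ↦ ⟨a⟩ is injective on H_0 ∪ ⋯ ∪ H_k. As the difference of two
-- vectors of height ≤ k has height ≤ 2k, and a balanced vector of height ≤ 2k splits into two of height ≤ k, this
-- says that ⟨c⟩ ≠ 0 for every nonzero balanced c of height ≤ 2k. Such a c is the difference of two multisets of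
-- indices of equal size ≤ 2k, which can be padded to size exactly 2k: this is the B_{2k} property. DD is the case
-- of height 2.
module Submission where

open import Defs
open import Data.Nat as ℕ using (ℕ; zero; suc; z≤n; s≤s; _≤_; _<_; _*_)
import Data.Nat.Properties as ℕP
import Data.Nat.ListAction as ListAction
open import Data.Integer as ℤ using (ℤ; +_; -[1+_]; +[1+_]; 0ℤ; 1ℤ; _+_; _-_; -_)
import Data.Integer.Properties as ℤP
open import Data.Integer.Tactic.RingSolver using (solve-∀)
open import Algebra.Properties.CommutativeSemigroup ℕP.+-commutativeSemigroup
  using () renaming (interchange to ℕ-+-interchange)
open import Algebra.Properties.CommutativeSemigroup ℤP.+-commutativeSemigroup
  using () renaming (interchange to ℤ-+-interchange)
open import Algebra.Properties.AbelianGroup ℤP.+-0-abelianGroup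
  using () renaming (∙-cancelʳ to ℤ-+-cancelʳ)
open import Data.Fin as Fin using (Fin; zero; suc)
import Data.Fin.Properties as FinP
open import Data.Vec as Vec using (Vec; []; _∷_; lookup; replicate; zipWith)
import Data.Vec.Properties as VecP
open import Data.Vec.Relation.Unary.All as VecAll using ([]; _∷_)
import Data.Vec.Relation.Unary.All.Properties as VecAllP
open import Data.Vec.Relation.Unary.AllPairs.Core using (AllPairs; []; _∷_)
open import Data.List as List using (List; []; _∷_; length; _++_)
import Data.List.Properties as ListP
open import Data.List.Relation.Unary.All as ListAll using (All; []; _∷_)
import Data.List.Relation.Unary.All.Properties as ListAllP
import Data.List.Relation.Unary.AllPairs as ListAllPairs
import Data.List.Relation.Unary.AllPairs.Properties as ListAllPairsP
open import Data.List.Relation.Unary.Any using (here; there)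
open import Data.List.Membership.Propositional using (_∈_; _─_)
open import Data.List.Membership.Propositional.Properties
open import Data.List.Relation.Unary.Unique.Propositional using (Unique)
import Data.List.Relation.Unary.Unique.Propositional.Properties as UniqueP
open import Data.List.Relation.Unary.Unique.DecPropositional.Properties _≟²_ using (deduplicate-!)
open import Data.Product using (_×_; ∃; ∃₂; _,_; proj₁; proj₂)
open import Data.Sum using (_⊎_; inj₁; inj₂)
open import Data.Empty using (⊥-elim)
open import Function using (_∘_)
open import Function.Bundles using (_⇔_; mk⇔; Equivalence)
open import Relation.Nullary using (¬_; yes; no)
open import Relation.Nullary.Decidable using (¬?)
open import Relation.Binary.Definitions using (DecidableEquality; tri<; tri≈; tri>)
open import Relation.Binary.PropositionalEquality

private
  variable
    m h : ℕ

infix  23 -²_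
infixr 22 _·²_

-²_ : ℤ² → ℤ²
-² (a , b) = (- a , - b)

_·²_ : ℤ → ℤ² → ℤ²
n ·² (a , b) = (n ℤ.* a , n ℤ.* b)

⊕-assoc : ∀ x y z → (x ⊕ y) ⊕ z ≡ x ⊕ (y ⊕ z)
⊕-assoc (a , b) (c , d) (e , f) = cong₂ _,_ (ℤP.+-assoc a c e) (ℤP.+-assoc b d f)

⊕-comm : ∀ x y → x ⊕ y ≡ y ⊕ x
⊕-comm (a , b) (c , d) = cong₂ _,_ (ℤP.+-comm a c) (ℤP.+-comm b d)

⊕-identityˡ : ∀ x → 0² ⊕ x ≡ x
⊕-identityˡ (a , b) = cong₂ _,_ (ℤP.+-identityˡ a) (ℤP.+-identityˡ b)

⊕-identityʳ : ∀ x → x ⊕ 0² ≡ x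
⊕-identityʳ (a , b) = cong₂ _,_ (ℤP.+-identityʳ a) (ℤP.+-identityʳ b)

⊕-inverseʳ : ∀ x → x ⊕ -² x ≡ 0²
⊕-inverseʳ (a , b) = cong₂ _,_ (ℤP.+-inverseʳ a) (ℤP.+-inverseʳ b)

⊕-interchange : ∀ x y z w → (x ⊕ y) ⊕ (z ⊕ w) ≡ (x ⊕ z) ⊕ (y ⊕ w)
⊕-interchange (a , b) (c , d) (e , f) (g , h) =
  cong₂ _,_ (ℤ-+-interchange a c e g) (ℤ-+-interchange b d f h)

-²-involutive : ∀ x → -² -² x ≡ x
-²-involutive (a , b) = cong₂ _,_ (ℤP.neg-involutive a) (ℤP.neg-involutive b)

neg-distrib-⊕ : ∀ x y → -² (x ⊕ y) ≡ -² x ⊕ -² y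
neg-distrib-⊕ (a , b) (c , d) = cong₂ _,_ (ℤP.neg-distrib-+ a c) (ℤP.neg-distrib-+ b d)

⊕≡0²⇒≡-² : ∀ x y → x ⊕ y ≡ 0² → x ≡ -² y
⊕≡0²⇒≡-² x y eq = begin
  x                ≡⟨ ⊕-identityʳ x ⟨
  x ⊕ 0²           ≡⟨ cong (x ⊕_) (⊕-inverseʳ y) ⟨
  x ⊕ (y ⊕ -² y)   ≡⟨ ⊕-assoc x y (-² y) ⟨
  (x ⊕ y) ⊕ -² y   ≡⟨ cong (_⊕ -² y) eq ⟩
  0² ⊕ -² y        ≡⟨ ⊕-identityˡ (-² y) ⟩
  -² y             ∎
  where open ≡-Reasoning

⊖≡⊖⇒⊕≡⊕ : ∀ x y z w → x ⊖ y ≡ z ⊖ w → x ⊕ w ≡ z ⊕ y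
⊖≡⊖⇒⊕≡⊕ (a , b) (c , d) (e , f) (g , h) eq =
  cong₂ _,_ (-≡-⇒+≡+ a c e g (cong proj₁ eq)) (-≡-⇒+≡+ b d f h (cong proj₂ eq))
  where
  -≡-⇒+≡+ : ∀ a b c d → a - b ≡ c - d → a + d ≡ c + b
  -≡-⇒+≡+ a b c d eq = begin
    a + d              ≡⟨ insert a b d ⟩
    (a - b) + (b + d)  ≡⟨ cong (_+ (b + d)) eq ⟩
    (c - d) + (b + d)  ≡⟨ cancel c d b ⟩
    c + b              ∎
    where
    open ≡-Reasoning
    insert : ∀ (a b d : ℤ) → a + d ≡ (a - b) + (b + d)
    insert = solve-∀
    cancel : ∀ (c d b : ℤ) → (c - d) + (b + d) ≡ c + b
    cancel = solve-∀

·²-distribʳ-+ : ∀ a b x → (a + b) ·² x ≡ a ·² x ⊕ b ·² x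
·²-distribʳ-+ a b (c , d) = cong₂ _,_ (ℤP.*-distribʳ-+ c a b) (ℤP.*-distribʳ-+ d a b)

neg-·² : ∀ a x → (- a) ·² x ≡ -² (a ·² x)
neg-·² a (c , d) = cong₂ _,_ (sym (ℤP.neg-distribˡ-* a c)) (sym (ℤP.neg-distribˡ-* a d))

·²-identityˡ : ∀ x → 1ℤ ·² x ≡ x
·²-identityˡ (a , b) = cong₂ _,_ (ℤP.*-identityˡ a) (ℤP.*-identityˡ b)

·²-zeroˡ : ∀ x → 0ℤ ·² x ≡ 0²
·²-zeroˡ (a , b) = refl

infixl 6 _+ᵛ_ _-ᵛ_ _+ᴺ_
infix  8 -ᵛ_

0ᵛ : Vec ℤ m
0ᵛ = replicate _ 0ℤ

_+ᵛ_ : Vec ℤ m → Vec ℤ m → Vec ℤ m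
_+ᵛ_ = zipWith _+_

-ᵛ_ : Vec ℤ m → Vec ℤ m
-ᵛ_ = Vec.map (λ x → - x)

_-ᵛ_ : Vec ℤ m → Vec ℤ m → Vec ℤ m
a -ᵛ b = a +ᵛ -ᵛ b

_+ᴺ_ : Vec ℕ m → Vec ℕ m → Vec ℕ m
_+ᴺ_ = zipWith ℕ._+_

toℤᵛ : Vec ℕ m → Vec ℤ m
toℤᵛ = Vec.map (λ n → + n)

unitᴺ : Fin m → Vec ℕ m
unitᴺ zero    = 1 ∷ replicate _ 0
unitᴺ (suc i) = 0 ∷ unitᴺ i

unit : Fin m → Vec ℤ m
unit i = toℤᵛ (unitᴺ i)

+ᵛ-identityˡ : (a : Vec ℤ m) → 0ᵛ +ᵛ a ≡ a
+ᵛ-identityˡ = VecP.zipWith-identityˡ ℤP.+-identityˡ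

+ᵛ-identityʳ : (a : Vec ℤ m) → a +ᵛ 0ᵛ ≡ a
+ᵛ-identityʳ = VecP.zipWith-identityʳ ℤP.+-identityʳ

+ᵛ-assoc : (a b c : Vec ℤ m) → (a +ᵛ b) +ᵛ c ≡ a +ᵛ (b +ᵛ c)
+ᵛ-assoc = VecP.zipWith-assoc ℤP.+-assoc

+ᵛ-inverseʳ : (a : Vec ℤ m) → a -ᵛ a ≡ 0ᵛ
+ᵛ-inverseʳ = VecP.zipWith-inverseʳ ℤP.+-inverseʳ

-ᵛ-identityʳ : (a : Vec ℤ m) → a -ᵛ 0ᵛ ≡ a
-ᵛ-identityʳ []      = refl
-ᵛ-identityʳ (x ∷ a) = cong₂ _∷_ (ℤP.+-identityʳ x) (-ᵛ-identityʳ a)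

-ᵛ-involutive : (a : Vec ℤ m) → -ᵛ -ᵛ a ≡ a
-ᵛ-involutive []      = refl
-ᵛ-involutive (x ∷ a) = cong₂ _∷_ (ℤP.neg-involutive x) (-ᵛ-involutive a)

difference≡0ᵛ⇒≡ : (a b : Vec ℤ m) → a -ᵛ b ≡ 0ᵛ → a ≡ b
difference≡0ᵛ⇒≡ []      []      _  = refl
difference≡0ᵛ⇒≡ (x ∷ a) (y ∷ b) eq =
  cong₂ _∷_ (ℤP.i-j≡0⇒i≡j x y (VecP.∷-injectiveˡ eq)) (difference≡0ᵛ⇒≡ a b (VecP.∷-injectiveʳ eq))

[a-b]+[[c-a]+b]≡c : (a b c : Vec ℤ m) → (a -ᵛ b) +ᵛ ((c -ᵛ a) +ᵛ b) ≡ c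
[a-b]+[[c-a]+b]≡c []      []      []      = refl
[a-b]+[[c-a]+b]≡c (x ∷ a) (y ∷ b) (z ∷ c) = cong₂ _∷_ (cancel x y z) ([a-b]+[[c-a]+b]≡c a b c)
  where
  cancel : ∀ (x y z : ℤ) → (x - y) + ((z - x) + y) ≡ z
  cancel = solve-∀

+ᴺ-cancelˡ : (a p q : Vec ℕ m) → a +ᴺ p ≡ a +ᴺ q → p ≡ q
+ᴺ-cancelˡ []      []      []      _  = refl
+ᴺ-cancelˡ (x ∷ a) (y ∷ p) (z ∷ q) eq =
  cong₂ _∷_ (ℕP.+-cancelˡ-≡ x y z (VecP.∷-injectiveˡ eq)) (+ᴺ-cancelˡ a p q (VecP.∷-injectiveʳ eq))

toℤᵛ-replicate-0 : toℤᵛ (replicate m 0) ≡ 0ᵛ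
toℤᵛ-replicate-0 = VecP.map-replicate (λ n → + n) 0 _

toℤᵛ-+ᴺ : (p q : Vec ℕ m) → toℤᵛ (p +ᴺ q) ≡ toℤᵛ p +ᵛ toℤᵛ q
toℤᵛ-+ᴺ []      []      = refl
toℤᵛ-+ᴺ (x ∷ p) (y ∷ q) = cong₂ _∷_ (ℤP.pos-+ x y) (toℤᵛ-+ᴺ p q)

toℤᵛ-injective : (p q : Vec ℕ m) → toℤᵛ p ≡ toℤᵛ q → p ≡ q
toℤᵛ-injective []      []      _  = refl
toℤᵛ-injective (x ∷ p) (y ∷ q) eq =
  cong₂ _∷_ (ℤP.+-injective (VecP.∷-injectiveˡ eq)) (toℤᵛ-injective p q (VecP.∷-injectiveʳ eq))

lookup-unitᴺ-≡ : (i : Fin m) → lookup (unitᴺ i) i ≡ 1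
lookup-unitᴺ-≡ zero    = refl
lookup-unitᴺ-≡ (suc i) = lookup-unitᴺ-≡ i

lookup-unitᴺ-≢ : {i t : Fin m} → i ≢ t → lookup (unitᴺ i) t ≡ 0
lookup-unitᴺ-≢ {i = zero}  {zero}  i≢t = ⊥-elim (i≢t refl)
lookup-unitᴺ-≢ {i = zero}  {suc t} _   = VecP.lookup-replicate t 0
lookup-unitᴺ-≢ {i = suc i} {zero}  _   = refl
lookup-unitᴺ-≢ {i = suc i} {suc t} i≢t = lookup-unitᴺ-≢ (i≢t ∘ cong suc)

lookup-difference-unit : (c : Vec ℤ m) {α β : Fin m} → α ≢ β → lookup (c -ᵛ unit α) β ≡ lookup c β
lookup-difference-unit c {α} {β} α≢β = begin
  lookup (c -ᵛ unit α) β              ≡⟨ VecP.lookup-zipWith _+_ β c (-ᵛ unit α) ⟩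
  lookup c β + lookup (-ᵛ unit α) β   ≡⟨ cong (_+_ (lookup c β)) (VecP.lookup-map β (λ x → - x) (unit α)) ⟩
  lookup c β - lookup (unit α) β      ≡⟨ cong (λ x → lookup c β - x) (VecP.lookup-map β (λ n → + n) (unitᴺ α)) ⟩
  lookup c β - + lookup (unitᴺ α) β   ≡⟨ cong (λ n → lookup c β - + n) (lookup-unitᴺ-≢ α≢β) ⟩
  lookup c β - 0ℤ                     ≡⟨ ℤP.+-identityʳ (lookup c β) ⟩
  lookup c β                          ∎
  where open ≡-Reasoning

-- The linear map a ↦ ∑ aᵢ vᵢ

linComb : (Fin m → ℤ²) → Vec ℤ m → ℤ²
linComb v []       = 0²
linComb v (a ∷ as) = a ·² v zero ⊕ linComb (v ∘ suc) as

linComb-0ᵛ : (v : Fin m → ℤ²) → linComb v 0ᵛ ≡ 0²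
linComb-0ᵛ {zero}  v = refl
linComb-0ᵛ {suc m} v = trans (cong (0ℤ ·² v zero ⊕_) (linComb-0ᵛ (v ∘ suc))) (⊕-identityʳ (0ℤ ·² v zero))

linComb-+ᵛ : (v : Fin m → ℤ²) (a b : Vec ℤ m) → linComb v (a +ᵛ b) ≡ linComb v a ⊕ linComb v b
linComb-+ᵛ v []      []      = sym (⊕-identityˡ 0²)
linComb-+ᵛ v (x ∷ a) (y ∷ b) = begin
  (x + y) ·² v zero ⊕ linComb (v ∘ suc) (a +ᵛ b)
    ≡⟨ cong₂ _⊕_ (·²-distribʳ-+ x y (v zero)) (linComb-+ᵛ (v ∘ suc) a b) ⟩
  (x ·² v zero ⊕ y ·² v zero) ⊕ (linComb (v ∘ suc) a ⊕ linComb (v ∘ suc) b)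
    ≡⟨ ⊕-interchange (x ·² v zero) (y ·² v zero) (linComb (v ∘ suc) a) (linComb (v ∘ suc) b) ⟩
  (x ·² v zero ⊕ linComb (v ∘ suc) a) ⊕ (y ·² v zero ⊕ linComb (v ∘ suc) b)
    ∎
  where open ≡-Reasoning

linComb-neg : (v : Fin m → ℤ²) (a : Vec ℤ m) → linComb v (-ᵛ a) ≡ -² linComb v a
linComb-neg v []      = refl
linComb-neg v (x ∷ a) =
  trans (cong₂ _⊕_ (neg-·² x (v zero)) (linComb-neg (v ∘ suc) a))
        (sym (neg-distrib-⊕ (x ·² v zero) (linComb (v ∘ suc) a)))

linComb-difference : (v : Fin m → ℤ²) (a b : Vec ℤ m) → linComb v (a -ᵛ b) ≡ linComb v a ⊕ -² linComb v b
linComb-difference v a b = trans (linComb-+ᵛ v a (-ᵛ b)) (cong (linComb v a ⊕_) (linComb-neg v b))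

linComb-difference-≡0² : (v : Fin m → ℤ²) {a b : Vec ℤ m} → linComb v a ≡ linComb v b → linComb v (a -ᵛ b) ≡ 0²
linComb-difference-≡0² v {a} {b} eq =
  trans (linComb-difference v a b) (trans (cong (_⊕ -² linComb v b) eq) (⊕-inverseʳ (linComb v b)))

linComb-unit : (v : Fin m → ℤ²) (i : Fin m) → linComb v (unit i) ≡ v i
linComb-unit v zero = begin
  1ℤ ·² v zero ⊕ linComb (v ∘ suc) (toℤᵛ (replicate _ 0))
    ≡⟨ cong (1ℤ ·² v zero ⊕_) (trans (cong (linComb (v ∘ suc)) toℤᵛ-replicate-0) (linComb-0ᵛ (v ∘ suc))) ⟩
  1ℤ ·² v zero ⊕ 0²
    ≡⟨ ⊕-identityʳ (1ℤ ·² v zero) ⟩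
  1ℤ ·² v zero
    ≡⟨ ·²-identityˡ (v zero) ⟩
  v zero
    ∎
  where open ≡-Reasoning
linComb-unit v (suc i) =
  trans (cong (_⊕ linComb (v ∘ suc) (unit i)) (·²-zeroˡ (v zero)))
        (trans (⊕-identityˡ (linComb (v ∘ suc) (unit i))) (linComb-unit (v ∘ suc) i))

-- Balance and height

Balanced : Vec ℤ m → Set
Balanced a = sumℤ a ≡ 0ℤ

negSum : Vec ℤ m → ℕ
negSum a = posSum (-ᵛ a)

sumℤ-0ᵛ : sumℤ (0ᵛ {m}) ≡ 0ℤ
sumℤ-0ᵛ {zero}  = refl
sumℤ-0ᵛ {suc m} = trans (ℤP.+-identityˡ (sumℤ (0ᵛ {m}))) (sumℤ-0ᵛ {m})

sumℤ-+ᵛ : (a b : Vec ℤ m) → sumℤ (a +ᵛ b) ≡ sumℤ a + sumℤ b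
sumℤ-+ᵛ []      []      = refl
sumℤ-+ᵛ (x ∷ a) (y ∷ b) =
  trans (cong (_+_ (x + y)) (sumℤ-+ᵛ a b)) (ℤ-+-interchange x y (sumℤ a) (sumℤ b))

sumℤ-neg : (a : Vec ℤ m) → sumℤ (-ᵛ a) ≡ - sumℤ a
sumℤ-neg []      = refl
sumℤ-neg (x ∷ a) = trans (cong (_+_ (- x)) (sumℤ-neg a)) (sym (ℤP.neg-distrib-+ x (sumℤ a)))

sumℤ-difference : (a b : Vec ℤ m) → sumℤ (a -ᵛ b) ≡ sumℤ a - sumℤ b
sumℤ-difference a b = trans (sumℤ-+ᵛ a (-ᵛ b)) (cong (_+_ (sumℤ a)) (sumℤ-neg b))

sumℤ-toℤᵛ : (p : Vec ℕ m) → sumℤ (toℤᵛ p) ≡ + Vec.sum p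
sumℤ-toℤᵛ []      = refl
sumℤ-toℤᵛ (x ∷ p) = trans (cong (_+_ (+ x)) (sumℤ-toℤᵛ p)) (sym (ℤP.pos-+ x (Vec.sum p)))

sum-replicate-0 : Vec.sum (replicate m 0) ≡ 0
sum-replicate-0 {zero}  = refl
sum-replicate-0 {suc m} = sum-replicate-0 {m}

sum-+ᴺ : (p q : Vec ℕ m) → Vec.sum (p +ᴺ q) ≡ Vec.sum p ℕ.+ Vec.sum q
sum-+ᴺ []      []      = refl
sum-+ᴺ (x ∷ p) (y ∷ q) =
  trans (cong ((x ℕ.+ y) ℕ.+_) (sum-+ᴺ p q)) (ℕ-+-interchange x y (Vec.sum p) (Vec.sum q))

sum-unitᴺ : (i : Fin m) → Vec.sum (unitᴺ i) ≡ 1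
sum-unitᴺ {suc m} zero    = cong suc (sum-replicate-0 {m})
sum-unitᴺ         (suc i) = sum-unitᴺ i

sumℤ-unit : (i : Fin m) → sumℤ (unit i) ≡ 1ℤ
sumℤ-unit i = trans (sumℤ-toℤᵛ (unitᴺ i)) (cong (λ n → + n) (sum-unitᴺ i))

sum≡0⇒≡replicate-0 : (p : Vec ℕ m) → Vec.sum p ≡ 0 → p ≡ replicate m 0
sum≡0⇒≡replicate-0 []      _  = refl
sum≡0⇒≡replicate-0 (x ∷ p) eq =
  cong₂ _∷_ (ℕP.m+n≡0⇒m≡0 x eq) (sum≡0⇒≡replicate-0 p (ℕP.m+n≡0⇒n≡0 x eq))

pos-mono : ∀ {x y} → x ℤ.≤ y → pos x ≤ pos y
pos-mono (ℤ.-≤- _) = z≤n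
pos-mono ℤ.-≤+     = z≤n
pos-mono (ℤ.+≤+ p) = p

pos-+ : ∀ x y → pos (x + y) ≤ pos x ℕ.+ pos y
pos-+ (+ a)    (+ b)    = ℕP.≤-refl
pos-+ (+ a)    -[1+ b ] = ℕP.≤-trans (pos-mono (ℤP.m⊖n≤m a (suc b))) (ℕP.m≤m+n a 0)
pos-+ -[1+ a ] (+ b)    = pos-mono (ℤP.m⊖n≤m b (suc a))
pos-+ -[1+ a ] -[1+ b ] = z≤n

posSum-0ᵛ : posSum (0ᵛ {m}) ≡ 0
posSum-0ᵛ {zero}  = refl
posSum-0ᵛ {suc m} = posSum-0ᵛ {m}

posSum-+ᵛ : (a b : Vec ℤ m) → posSum (a +ᵛ b) ≤ posSum a ℕ.+ posSum b
posSum-+ᵛ []      []      = z≤n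
posSum-+ᵛ (x ∷ a) (y ∷ b) =
  ℕP.≤-trans (ℕP.+-mono-≤ (pos-+ x y) (posSum-+ᵛ a b))
             (ℕP.≤-reflexive (ℕ-+-interchange (pos x) (pos y) (posSum a) (posSum b)))

posSum-toℤᵛ : (p : Vec ℕ m) → posSum (toℤᵛ p) ≡ Vec.sum p
posSum-toℤᵛ []      = refl
posSum-toℤᵛ (x ∷ p) = cong (x ℕ.+_) (posSum-toℤᵛ p)

negSum-toℤᵛ : (p : Vec ℕ m) → negSum (toℤᵛ p) ≡ 0
negSum-toℤᵛ []          = refl
negSum-toℤᵛ (zero  ∷ p) = negSum-toℤᵛ p
negSum-toℤᵛ (suc _ ∷ p) = negSum-toℤᵛ p

positivePart : Vec ℤ m → Vec ℕ m
positivePart = Vec.map pos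

negativePart : Vec ℤ m → Vec ℕ m
negativePart = Vec.map (λ x → pos (- x))

sum-positivePart : (a : Vec ℤ m) → Vec.sum (positivePart a) ≡ posSum a
sum-positivePart []      = refl
sum-positivePart (x ∷ a) = cong (pos x ℕ.+_) (sum-positivePart a)

sum-negativePart : (a : Vec ℤ m) → Vec.sum (negativePart a) ≡ negSum a
sum-negativePart []      = refl
sum-negativePart (x ∷ a) = cong (pos (- x) ℕ.+_) (sum-negativePart a)

toℤᵛ-positivePart : (a : Vec ℤ m) → toℤᵛ (positivePart a) ≡ toℤᵛ (negativePart a) +ᵛ a
toℤᵛ-positivePart []      = refl
toℤᵛ-positivePart (x ∷ a) = cong₂ _∷_ (pos≡pos-neg+ x) (toℤᵛ-positivePart a)
  where
  pos≡pos-neg+ : ∀ x → + pos x ≡ + pos (- x) + x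
  pos≡pos-neg+ (+ zero) = refl
  pos≡pos-neg+ +[1+ n ] = sym (ℤP.+-identityˡ +[1+ n ])
  pos≡pos-neg+ -[1+ n ] = sym (ℤP.+-inverseʳ +[1+ n ])

positivePart≡negativePart⇒≡0ᵛ : (a : Vec ℤ m) → positivePart a ≡ negativePart a → a ≡ 0ᵛ
positivePart≡negativePart⇒≡0ᵛ []      _  = refl
positivePart≡negativePart⇒≡0ᵛ (x ∷ a) eq =
  cong₂ _∷_ (pos≡pos-neg⇒≡0 x (VecP.∷-injectiveˡ eq)) (positivePart≡negativePart⇒≡0ᵛ a (VecP.∷-injectiveʳ eq))
  where
  pos≡pos-neg⇒≡0 : ∀ x → pos x ≡ pos (- x) → x ≡ 0ℤ
  pos≡pos-neg⇒≡0 (+ zero) _  = refl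
  pos≡pos-neg⇒≡0 +[1+ n ] ()
  pos≡pos-neg⇒≡0 -[1+ n ] ()

balanced⇒posSum≡negSum : (a : Vec ℤ m) → Balanced a → posSum a ≡ negSum a
balanced⇒posSum≡negSum a bal = ℤP.+-injective (begin
  + posSum a                              ≡⟨ cong (λ n → + n) (sum-positivePart a) ⟨
  + Vec.sum (positivePart a)              ≡⟨ sumℤ-toℤᵛ (positivePart a) ⟨
  sumℤ (toℤᵛ (positivePart a))            ≡⟨ cong sumℤ (toℤᵛ-positivePart a) ⟩
  sumℤ (toℤᵛ (negativePart a) +ᵛ a)       ≡⟨ sumℤ-+ᵛ (toℤᵛ (negativePart a)) a ⟩
  sumℤ (toℤᵛ (negativePart a)) + sumℤ a   ≡⟨ cong₂ _+_ (sumℤ-toℤᵛ (negativePart a)) bal ⟩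
  + Vec.sum (negativePart a) + 0ℤ         ≡⟨ ℤP.+-identityʳ (+ Vec.sum (negativePart a)) ⟩
  + Vec.sum (negativePart a)              ≡⟨ cong (λ n → + n) (sum-negativePart a) ⟩
  + negSum a                              ∎)
  where open ≡-Reasoning

balanced∧posSum≡0⇒≡0ᵛ : (a : Vec ℤ m) → Balanced a → posSum a ≡ 0 → a ≡ 0ᵛ
balanced∧posSum≡0⇒≡0ᵛ a bal eq = positivePart≡negativePart⇒≡0ᵛ a (begin
  positivePart a   ≡⟨ sum≡0⇒≡replicate-0 (positivePart a) (trans (sum-positivePart a) eq) ⟩
  replicate _ 0    ≡⟨ sum≡0⇒≡replicate-0 (negativePart a) (trans (sum-negativePart a) negSum≡0) ⟨
  negativePart a   ∎)
  where
  open ≡-Reasoning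
  negSum≡0 : negSum a ≡ 0
  negSum≡0 = trans (sym (balanced⇒posSum≡negSum a bal)) eq

-- Hop sums as balanced combinations

OffDiagonal : Fin m × Fin m → Set
OffDiagonal (α , β) = α ≢ β

coefficients : List (Fin m × Fin m) → Vec ℤ m
coefficients []             = 0ᵛ
coefficients ((α , β) ∷ ps) = (unit α -ᵛ unit β) +ᵛ coefficients ps

linComb-coefficients : (v : Fin m → ℤ²) (ps : List (Fin m × Fin m)) → linComb v (coefficients ps) ≡ hopSum v ps
linComb-coefficients v []             = linComb-0ᵛ v
linComb-coefficients v ((α , β) ∷ ps) = begin
  linComb v ((unit α -ᵛ unit β) +ᵛ coefficients ps)
    ≡⟨ linComb-+ᵛ v (unit α -ᵛ unit β) (coefficients ps) ⟩
  linComb v (unit α -ᵛ unit β) ⊕ linComb v (coefficients ps)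
    ≡⟨ cong₂ _⊕_ (linComb-difference v (unit α) (unit β)) (linComb-coefficients v ps) ⟩
  (linComb v (unit α) ⊕ -² linComb v (unit β)) ⊕ hopSum v ps
    ≡⟨ cong (_⊕ hopSum v ps) (cong₂ (λ x y → x ⊕ -² y) (linComb-unit v α) (linComb-unit v β)) ⟩
  (v α ⊖ v β) ⊕ hopSum v ps
    ∎
  where open ≡-Reasoning

balanced-coefficients : (ps : List (Fin m × Fin m)) → Balanced (coefficients ps)
balanced-coefficients {m} []             = sumℤ-0ᵛ {m}
balanced-coefficients     ((α , β) ∷ ps) =
  trans (sumℤ-+ᵛ (unit α -ᵛ unit β) (coefficients ps))
        (cong₂ _+_ (trans (sumℤ-difference (unit α) (unit β)) (cong₂ _-_ (sumℤ-unit α) (sumℤ-unit β)))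
                   (balanced-coefficients ps))

posSum-coefficients : (ps : List (Fin m × Fin m)) → posSum (coefficients ps) ≤ length ps
posSum-coefficients {m} []             = ℕP.≤-reflexive (posSum-0ᵛ {m})
posSum-coefficients     ((α , β) ∷ ps) = begin
  posSum ((unit α -ᵛ unit β) +ᵛ coefficients ps)
    ≤⟨ posSum-+ᵛ (unit α -ᵛ unit β) (coefficients ps) ⟩
  posSum (unit α -ᵛ unit β) ℕ.+ posSum (coefficients ps)
    ≤⟨ ℕP.+-mono-≤ (posSum-+ᵛ (unit α) (-ᵛ unit β)) (posSum-coefficients ps) ⟩
  (posSum (unit α) ℕ.+ negSum (unit β)) ℕ.+ length ps
    ≡⟨ cong₂ (λ x y → (x ℕ.+ y) ℕ.+ length ps)
             (trans (posSum-toℤᵛ (unitᴺ α)) (sum-unitᴺ α)) (negSum-toℤᵛ (unitᴺ β)) ⟩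
  suc (length ps)
    ∎
  where open ℕP.≤-Reasoning

coefficients-++ : (xs ys : List (Fin m × Fin m)) →
                  coefficients (xs ++ ys) ≡ coefficients xs +ᵛ coefficients ys
coefficients-++ []             ys = sym (+ᵛ-identityˡ (coefficients ys))
coefficients-++ ((α , β) ∷ xs) ys =
  trans (cong ((unit α -ᵛ unit β) +ᵛ_) (coefficients-++ xs ys))
        (sym (+ᵛ-assoc (unit α -ᵛ unit β) (coefficients xs) (coefficients ys)))

∃-positive-entry : (c : Vec ℤ m) {p : ℕ} → posSum c ≡ suc p → ∃₂ λ α n → lookup c α ≡ +[1+ n ]
∃-positive-entry (+[1+ n ] ∷ c) eq = zero , n , refl
∃-positive-entry (+ zero   ∷ c) eq with ∃-positive-entry c eq
... | α , n , cα = suc α , n , cα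
∃-positive-entry (-[1+ _ ] ∷ c) eq with ∃-positive-entry c eq
... | α , n , cα = suc α , n , cα

∃-negative-entry : (c : Vec ℤ m) {p : ℕ} → Balanced c → posSum c ≡ suc p → ∃₂ λ β n → lookup c β ≡ -[1+ n ]
∃-negative-entry c bal eq with ∃-positive-entry (-ᵛ c) (trans (sym (balanced⇒posSum≡negSum c bal)) eq)
... | β , n , -cβ = β , n , (begin
  lookup c β          ≡⟨ ℤP.neg-involutive (lookup c β) ⟨
  - - lookup c β      ≡⟨ cong -_ (VecP.lookup-map β (λ x → - x) c) ⟨
  - lookup (-ᵛ c) β   ≡⟨ cong -_ -cβ ⟩
  -[1+ n ]            ∎)
  where open ≡-Reasoning

posSum-difference-unit : (c : Vec ℤ m) (α : Fin m) {n : ℕ} → lookup c α ≡ +[1+ n ] →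
                         posSum c ≡ suc (posSum (c -ᵛ unit α))
posSum-difference-unit (x ∷ c) zero    refl =
  cong (λ d → suc (_ ℕ.+ posSum d)) (sym (trans (cong (_-ᵛ_ c) toℤᵛ-replicate-0) (-ᵛ-identityʳ c)))
posSum-difference-unit (x ∷ c) (suc α) cα = begin
  pos x ℕ.+ posSum c                           ≡⟨ cong (pos x ℕ.+_) (posSum-difference-unit c α cα) ⟩
  pos x ℕ.+ suc (posSum (c -ᵛ unit α))         ≡⟨ ℕP.+-suc (pos x) (posSum (c -ᵛ unit α)) ⟩
  suc (pos x ℕ.+ posSum (c -ᵛ unit α))         ≡⟨ cong (λ y → suc (pos y ℕ.+ posSum (c -ᵛ unit α))) (ℤP.+-identityʳ x) ⟨
  suc (pos (x - 0ℤ) ℕ.+ posSum (c -ᵛ unit α))  ∎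
  where open ≡-Reasoning

posSum-+ᵛ-unit : (c : Vec ℤ m) (β : Fin m) {n : ℕ} → lookup c β ≡ -[1+ n ] → posSum (c +ᵛ unit β) ≡ posSum c
posSum-+ᵛ-unit (x ∷ c) zero {n} refl =
  cong₂ ℕ._+_ (pos-[1+n]+1 n) (cong posSum (trans (cong (c +ᵛ_) toℤᵛ-replicate-0) (+ᵛ-identityʳ c)))
  where
  pos-[1+n]+1 : ∀ n → pos (-[1+ n ] + 1ℤ) ≡ 0
  pos-[1+n]+1 zero    = refl
  pos-[1+n]+1 (suc n) = refl
posSum-+ᵛ-unit (x ∷ c) (suc β) cβ = cong₂ ℕ._+_ (cong pos (ℤP.+-identityʳ x)) (posSum-+ᵛ-unit c β cβ)

-- Pair a positive entry with a negative one and recurse on the remainder.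
decompose : ∀ p (c : Vec ℤ m) → Balanced c → posSum c ≡ p →
            ∃ λ ps → length ps ≡ p × All OffDiagonal ps × coefficients ps ≡ c
decompose zero    c bal eq = [] , refl , [] , sym (balanced∧posSum≡0⇒≡0ᵛ c bal eq)
decompose (suc p) c bal eq with ∃-positive-entry c eq | ∃-negative-entry c bal eq
... | α , n , cα | β , n′ , cβ =
  let ps , len , off , ps↦c′ = decompose p c′ bal′ eq′
  in  (α , β) ∷ ps , cong suc len , α≢β ∷ off ,
      trans (cong ((unit α -ᵛ unit β) +ᵛ_) ps↦c′) ([a-b]+[[c-a]+b]≡c (unit α) (unit β) c)
  where
  α≢β : α ≢ β
  α≢β refl with trans (sym cα) cβ
  ... | ()
  c′ : Vec ℤ _
  c′ = (c -ᵛ unit α) +ᵛ unit β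
  bal′ : Balanced c′
  bal′ = trans (sumℤ-+ᵛ (c -ᵛ unit α) (unit β))
               (cong₂ _+_ (trans (sumℤ-difference c (unit α)) (cong₂ _-_ bal (sumℤ-unit α))) (sumℤ-unit β))
  eq′ : posSum c′ ≡ p
  eq′ = trans (posSum-+ᵛ-unit (c -ᵛ unit α) β (trans (lookup-difference-unit c α≢β) cβ))
              (ℕP.suc-injective (trans (sym (posSum-difference-unit c α cα)) eq))

-- B_h sequences and balanced relations

NoRelationUpTo : ℕ → (Fin m → ℤ²) → Set
NoRelationUpTo {m} h v = ∀ (c : Vec ℤ m) → Balanced c → posSum c ≤ h → linComb v c ≡ 0² → c ≡ 0ᵛ

noRelation-mono : ∀ {h h′} {v : Fin m → ℤ²} → h′ ≤ h → NoRelationUpTo h v → NoRelationUpTo h′ v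
noRelation-mono h′≤h noRel c bal height = noRel c bal (ℕP.≤-trans height h′≤h)

multiplicity : Vec (Fin m) h → Vec ℕ m
multiplicity []      = replicate _ 0
multiplicity (i ∷ s) = unitᴺ i +ᴺ multiplicity s

MultisetInjective : ℕ → (Fin m → ℤ²) → Set
MultisetInjective {m} h v = ∀ (p q : Vec ℕ m) → Vec.sum p ≡ h → Vec.sum q ≡ h →
                            linComb v (toℤᵛ p) ≡ linComb v (toℤᵛ q) → p ≡ q

Sorted : Vec (Fin m) h → Set
Sorted = AllPairs Fin._≤_

sum-multiplicity : (s : Vec (Fin m) h) → Vec.sum (multiplicity s) ≡ h
sum-multiplicity {m} []      = sum-replicate-0 {m}
sum-multiplicity     (i ∷ s) =
  trans (sum-+ᴺ (unitᴺ i) (multiplicity s)) (cong₂ ℕ._+_ (sum-unitᴺ i) (sum-multiplicity s))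

linComb-multiplicity : (v : Fin m → ℤ²) (s : Vec (Fin m) h) → linComb v (toℤᵛ (multiplicity s)) ≡ indexSum v s
linComb-multiplicity v []      = trans (cong (linComb v) toℤᵛ-replicate-0) (linComb-0ᵛ v)
linComb-multiplicity v (i ∷ s) = begin
  linComb v (toℤᵛ (unitᴺ i +ᴺ multiplicity s))            ≡⟨ cong (linComb v) (toℤᵛ-+ᴺ (unitᴺ i) (multiplicity s)) ⟩
  linComb v (unit i +ᵛ toℤᵛ (multiplicity s))             ≡⟨ linComb-+ᵛ v (unit i) (toℤᵛ (multiplicity s)) ⟩
  linComb v (unit i) ⊕ linComb v (toℤᵛ (multiplicity s))  ≡⟨ cong₂ _⊕_ (linComb-unit v i) (linComb-multiplicity v s) ⟩
  v i ⊕ indexSum v s                                       ∎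
  where open ≡-Reasoning

lookup-multiplicity-∷ : (x : Fin m) (s : Vec (Fin m) h) →
                        lookup (multiplicity (x ∷ s)) x ≡ suc (lookup (multiplicity s) x)
lookup-multiplicity-∷ x s =
  trans (VecP.lookup-zipWith ℕ._+_ x (unitᴺ x) (multiplicity s))
        (cong (ℕ._+ lookup (multiplicity s) x) (lookup-unitᴺ-≡ x))

lookup-multiplicity-∉ : (x : Fin m) (s : Vec (Fin m) h) → VecAll.All (x ≢_) s → lookup (multiplicity s) x ≡ 0
lookup-multiplicity-∉ x []      []          = VecP.lookup-replicate x 0
lookup-multiplicity-∉ x (y ∷ s) (x≢y ∷ x∉s) =
  trans (VecP.lookup-zipWith ℕ._+_ x (unitᴺ y) (multiplicity s))
        (cong₂ ℕ._+_ (lookup-unitᴺ-≢ (x≢y ∘ sym)) (lookup-multiplicity-∉ x s x∉s))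

nonDecr⇒sorted : (s : Vec (Fin m) h) → NonDecr s → Sorted s
nonDecr⇒sorted []      _  = []
nonDecr⇒sorted (x ∷ s) nd =
  VecAllP.lookup⁻ (λ a → nd zero (suc a) z≤n) ∷ nonDecr⇒sorted s (λ a b a≤b → nd (suc a) (suc b) (s≤s a≤b))

sorted⇒nonDecr : (s : Vec (Fin m) h) → Sorted s → NonDecr s
sorted⇒nonDecr (x ∷ s) _              zero    zero    _         = ℕP.≤-refl
sorted⇒nonDecr (x ∷ s) (x≤s ∷ _)      zero    (suc b) _         = VecAllP.lookup⁺ x≤s b
sorted⇒nonDecr (x ∷ s) (_ ∷ sorted-s) (suc a) (suc b) (s≤s a≤b) = sorted⇒nonDecr s sorted-s a b a≤b

multiplicity-head-≮ : {x y : Fin m} (s t : Vec (Fin m) h) → VecAll.All (y Fin.≤_) t →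
                      multiplicity (x ∷ s) ≡ multiplicity (y ∷ t) → ¬ x Fin.< y
multiplicity-head-≮ {x = x} {y} s t y≤t eq x<y = ℕP.1+n≢0 (begin
  suc (lookup (multiplicity s) x)   ≡⟨ lookup-multiplicity-∷ x s ⟨
  lookup (multiplicity (x ∷ s)) x   ≡⟨ cong (λ p → lookup p x) eq ⟩
  lookup (multiplicity (y ∷ t)) x   ≡⟨ lookup-multiplicity-∉ x (y ∷ t) (FinP.<⇒≢ x<y ∷ VecAll.map x≢ y≤t) ⟩
  0                                 ∎)
  where
  open ≡-Reasoning
  x≢ : ∀ {z} → y Fin.≤ z → x ≢ z
  x≢ y≤z = FinP.<⇒≢ (ℕP.<-≤-trans x<y y≤z)

sorted-multiplicity-injective : (s t : Vec (Fin m) h) → Sorted s → Sorted t →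
                                multiplicity s ≡ multiplicity t → s ≡ t
sorted-multiplicity-injective []      []      _                _                _  = refl
sorted-multiplicity-injective (x ∷ s) (y ∷ t) (x≤s ∷ sorted-s) (y≤t ∷ sorted-t) eq with FinP.<-cmp x y
... | tri< x<y _ _  = ⊥-elim (multiplicity-head-≮ s t y≤t eq x<y)
... | tri> _ _ y<x  = ⊥-elim (multiplicity-head-≮ t s x≤s (sym eq) y<x)
... | tri≈ _ refl _ = cong (x ∷_) (sorted-multiplicity-injective s t sorted-s sorted-t
                                     (+ᴺ-cancelˡ (unitᴺ x) (multiplicity s) (multiplicity t) eq))

expand : (p : Vec ℕ m) → Vec (Fin m) (Vec.sum p)
expand []      = []
expand (n ∷ p) = replicate n zero Vec.++ Vec.map suc (expand p)

sorted-map-suc : {s : Vec (Fin m) h} → Sorted s → Sorted (Vec.map suc s)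
sorted-map-suc []               = []
sorted-map-suc (x≤s ∷ sorted-s) = VecAllP.map⁺ (VecAll.map s≤s x≤s) ∷ sorted-map-suc sorted-s

sorted-zeros-++ : ∀ n {s : Vec (Fin (suc m)) h} → Sorted s → Sorted (replicate n zero Vec.++ s)
sorted-zeros-++ zero    sorted-s = sorted-s
sorted-zeros-++ (suc n) sorted-s = VecAll.universal (λ _ → z≤n) _ ∷ sorted-zeros-++ n sorted-s

sorted-expand : (p : Vec ℕ m) → Sorted (expand p)
sorted-expand []      = []
sorted-expand (n ∷ p) = sorted-zeros-++ n (sorted-map-suc (sorted-expand p))

multiplicity-map-suc : (s : Vec (Fin m) h) → multiplicity (Vec.map suc s) ≡ 0 ∷ multiplicity s
multiplicity-map-suc []      = refl
multiplicity-map-suc (i ∷ s) = cong (unitᴺ (suc i) +ᴺ_) (multiplicity-map-suc s)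

multiplicity-zeros-++ : ∀ n (s : Vec (Fin m) h) →
                        multiplicity (replicate n zero Vec.++ Vec.map suc s) ≡ n ∷ multiplicity s
multiplicity-zeros-++ zero    s = multiplicity-map-suc s
multiplicity-zeros-++ (suc n) s =
  trans (cong (unitᴺ zero +ᴺ_) (multiplicity-zeros-++ n s))
        (cong (suc n ∷_) (VecP.zipWith-identityˡ ℕP.+-identityˡ (multiplicity s)))

multiplicity-expand : (p : Vec ℕ m) → multiplicity (expand p) ≡ p
multiplicity-expand []      = refl
multiplicity-expand (n ∷ p) = trans (multiplicity-zeros-++ n (expand p)) (cong (n ∷_) (multiplicity-expand p))

sorted-realization : (p : Vec ℕ m) → Vec.sum p ≡ h → ∃ λ (s : Vec (Fin m) h) → Sorted s × multiplicity s ≡ p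
sorted-realization p refl = expand p , sorted-expand p , multiplicity-expand p

Bh⇒multisetInjective : (v : Fin m → ℤ²) → IsBh h v → MultisetInjective h v
Bh⇒multisetInjective v Bh p q sum-p sum-q eq with sorted-realization p sum-p | sorted-realization q sum-q
... | s , sorted-s , refl | t , sorted-t , refl =
  cong multiplicity (Bh s t (sorted⇒nonDecr s sorted-s) (sorted⇒nonDecr t sorted-t)
                         (trans (sym (linComb-multiplicity v s)) (trans eq (linComb-multiplicity v t))))

multisetInjective⇒Bh : (v : Fin m → ℤ²) → MultisetInjective h v → IsBh h v
multisetInjective⇒Bh v inj s t nd-s nd-t eq =
  sorted-multiplicity-injective s t (nonDecr⇒sorted s nd-s) (nonDecr⇒sorted t nd-t)
    (inj (multiplicity s) (multiplicity t) (sum-multiplicity s) (sum-multiplicity t)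
         (trans (linComb-multiplicity v s) (trans eq (sym (linComb-multiplicity v t)))))

noRelation⇒multisetInjective : (v : Fin m → ℤ²) → NoRelationUpTo h v → MultisetInjective h v
noRelation⇒multisetInjective v noRel p q refl sum-q eq =
  toℤᵛ-injective p q (difference≡0ᵛ⇒≡ (toℤᵛ p) (toℤᵛ q)
    (noRel (toℤᵛ p -ᵛ toℤᵛ q) balanced height (linComb-difference-≡0² v eq)))
  where
  balanced : Balanced (toℤᵛ p -ᵛ toℤᵛ q)
  balanced = begin
    sumℤ (toℤᵛ p -ᵛ toℤᵛ q)         ≡⟨ sumℤ-difference (toℤᵛ p) (toℤᵛ q) ⟩
    sumℤ (toℤᵛ p) - sumℤ (toℤᵛ q)   ≡⟨ cong₂ _-_ (sumℤ-toℤᵛ p) (trans (sumℤ-toℤᵛ q) (cong (λ n → + n) sum-q)) ⟩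
    + Vec.sum p - + Vec.sum p       ≡⟨ ℤP.+-inverseʳ (+ Vec.sum p) ⟩
    0ℤ                              ∎
    where open ≡-Reasoning
  height : posSum (toℤᵛ p -ᵛ toℤᵛ q) ≤ Vec.sum p
  height = begin
    posSum (toℤᵛ p -ᵛ toℤᵛ q)             ≤⟨ posSum-+ᵛ (toℤᵛ p) (-ᵛ toℤᵛ q) ⟩
    posSum (toℤᵛ p) ℕ.+ negSum (toℤᵛ q)   ≡⟨ cong₂ ℕ._+_ (posSum-toℤᵛ p) (negSum-toℤᵛ q) ⟩
    Vec.sum p ℕ.+ 0                       ≡⟨ ℕP.+-identityʳ (Vec.sum p) ⟩
    Vec.sum p                             ∎
    where open ℕP.≤-Reasoning

padFirst : ℕ → Vec ℕ (suc m) → Vec ℕ (suc m)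
padFirst r (x ∷ p) = (r ℕ.+ x) ∷ p

sum-padFirst : ∀ r (p : Vec ℕ (suc m)) → Vec.sum (padFirst r p) ≡ r ℕ.+ Vec.sum p
sum-padFirst r (x ∷ p) = ℕP.+-assoc r x (Vec.sum p)

linComb-padFirst : (v : Fin (suc m) → ℤ²) (r : ℕ) (p : Vec ℕ (suc m)) →
                   linComb v (toℤᵛ (padFirst r p)) ≡ (+ r) ·² v zero ⊕ linComb v (toℤᵛ p)
linComb-padFirst v r (x ∷ p) = begin
  (+ (r ℕ.+ x)) ·² v zero ⊕ rest                ≡⟨ cong (λ y → y ·² v zero ⊕ rest) (ℤP.pos-+ r x) ⟩
  (+ r + + x) ·² v zero ⊕ rest                  ≡⟨ cong (_⊕ rest) (·²-distribʳ-+ (+ r) (+ x) (v zero)) ⟩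
  ((+ r) ·² v zero ⊕ (+ x) ·² v zero) ⊕ rest    ≡⟨ ⊕-assoc ((+ r) ·² v zero) ((+ x) ·² v zero) rest ⟩
  (+ r) ·² v zero ⊕ ((+ x) ·² v zero ⊕ rest)    ∎
  where
  open ≡-Reasoning
  rest : ℤ²
  rest = linComb (v ∘ suc) (toℤᵛ p)

padFirst-injective : ∀ r (p q : Vec ℕ (suc m)) → padFirst r p ≡ padFirst r q → p ≡ q
padFirst-injective r (x ∷ p) (y ∷ q) eq =
  cong₂ _∷_ (ℕP.+-cancelˡ-≡ r x y (VecP.∷-injectiveˡ eq)) (VecP.∷-injectiveʳ eq)

-- Padding the first index brings the positive and the negative part of c to size exactly h.
multisetInjective⇒noRelation : (v : Fin m → ℤ²) → MultisetInjective h v → NoRelationUpTo h v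
multisetInjective⇒noRelation {zero}      v inj [] _ _ _ = refl
multisetInjective⇒noRelation {suc m} {h} v inj c bal height lin≡0 =
  positivePart≡negativePart⇒≡0ᵛ c (padFirst-injective r c⁺ c⁻
    (inj (padFirst r c⁺) (padFirst r c⁻) (padded-size c⁺ (sum-positivePart c)) (padded-size c⁻ sum-c⁻) (begin
      linComb v (toℤᵛ (padFirst r c⁺))       ≡⟨ linComb-padFirst v r c⁺ ⟩
      (+ r) ·² v zero ⊕ linComb v (toℤᵛ c⁺)  ≡⟨ cong ((+ r) ·² v zero ⊕_) same-linComb ⟩
      (+ r) ·² v zero ⊕ linComb v (toℤᵛ c⁻)  ≡⟨ linComb-padFirst v r c⁻ ⟨
      linComb v (toℤᵛ (padFirst r c⁻))       ∎)))
  where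
  open ≡-Reasoning
  c⁺ c⁻ : Vec ℕ (suc m)
  c⁺ = positivePart c
  c⁻ = negativePart c
  r : ℕ
  r = h ℕ.∸ posSum c
  padded-size : ∀ p → Vec.sum p ≡ posSum c → Vec.sum (padFirst r p) ≡ h
  padded-size p eq = trans (sum-padFirst r p) (trans (cong (r ℕ.+_) eq) (ℕP.m∸n+n≡m height))
  sum-c⁻ : Vec.sum c⁻ ≡ posSum c
  sum-c⁻ = trans (sum-negativePart c) (sym (balanced⇒posSum≡negSum c bal))
  same-linComb : linComb v (toℤᵛ c⁺) ≡ linComb v (toℤᵛ c⁻)
  same-linComb = begin
    linComb v (toℤᵛ c⁺)                 ≡⟨ cong (linComb v) (toℤᵛ-positivePart c) ⟩
    linComb v (toℤᵛ c⁻ +ᵛ c)            ≡⟨ linComb-+ᵛ v (toℤᵛ c⁻) c ⟩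
    linComb v (toℤᵛ c⁻) ⊕ linComb v c   ≡⟨ cong (linComb v (toℤᵛ c⁻) ⊕_) lin≡0 ⟩
    linComb v (toℤᵛ c⁻) ⊕ 0²            ≡⟨ ⊕-identityʳ (linComb v (toℤᵛ c⁻)) ⟩
    linComb v (toℤᵛ c⁻)                 ∎

Bh⇔noRelation : (v : Fin m → ℤ²) → IsBh h v ⇔ NoRelationUpTo h v
Bh⇔noRelation v = mk⇔ (multisetInjective⇒noRelation v ∘ Bh⇒multisetInjective v)
                      (multisetInjective⇒Bh v ∘ noRelation⇒multisetInjective v)

-- vᵢ - vⱼ = vᵢ′ - vⱼ′ says that the multisets {i, j′} and {i′, j} have the same sum.
multisetInjective⇒DD : (v : Fin m → ℤ²) → MultisetInjective 2 v → IsDD v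
multisetInjective⇒DD v inj i j i′ j′ i≢j i′≢j′ eq =
  first-agrees i≢j sums , sym (first-agrees (i′≢j′ ∘ sym) sums′)
  where
  sums : v i ⊕ v j′ ≡ v i′ ⊕ v j
  sums = ⊖≡⊖⇒⊕≡⊕ (v i) (v j) (v i′) (v j′) eq
  sums′ : v j′ ⊕ v i ≡ v j ⊕ v i′
  sums′ = trans (⊕-comm (v j′) (v i)) (trans sums (⊕-comm (v i′) (v j)))
  indexSum-pair : ∀ a b → indexSum v (a ∷ b ∷ []) ≡ v a ⊕ v b
  indexSum-pair a b = cong (v a ⊕_) (⊕-identityʳ (v b))
  first-agrees : ∀ {a b a′ b′} → a ≢ b → v a ⊕ v b′ ≡ v a′ ⊕ v b → a ≡ a′
  first-agrees {a} {b} {a′} {b′} a≢b eq with a′ Fin.≟ a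
  ... | yes a′≡a = sym a′≡a
  ... | no  a′≢a = ⊥-elim (ℕP.1+n≢0 (begin
    suc (lookup (multiplicity (b′ ∷ [])) a)   ≡⟨ lookup-multiplicity-∷ a (b′ ∷ []) ⟨
    lookup (multiplicity (a ∷ b′ ∷ [])) a     ≡⟨ cong (λ p → lookup p a) same-multiset ⟩
    lookup (multiplicity (a′ ∷ b ∷ [])) a     ≡⟨ lookup-multiplicity-∉ a (a′ ∷ b ∷ []) ((a′≢a ∘ sym) ∷ a≢b ∷ []) ⟩
    0                                         ∎))
    where
    open ≡-Reasoning
    same-multiset : multiplicity (a ∷ b′ ∷ []) ≡ multiplicity (a′ ∷ b ∷ [])
    same-multiset = inj _ _ (sum-multiplicity (a ∷ b′ ∷ [])) (sum-multiplicity (a′ ∷ b ∷ [])) (begin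
      linComb v (toℤᵛ (multiplicity (a ∷ b′ ∷ [])))   ≡⟨ linComb-multiplicity v (a ∷ b′ ∷ []) ⟩
      indexSum v (a ∷ b′ ∷ [])                        ≡⟨ indexSum-pair a b′ ⟩
      v a ⊕ v b′                                      ≡⟨ eq ⟩
      v a′ ⊕ v b                                      ≡⟨ indexSum-pair a′ b ⟨
      indexSum v (a′ ∷ b ∷ [])                        ≡⟨ linComb-multiplicity v (a′ ∷ b ∷ []) ⟨
      linComb v (toℤᵛ (multiplicity (a′ ∷ b ∷ [])))   ∎)

-- Injectivity on H₀ ∪ ⋯ ∪ H_k, the balanced vectors of height ≤ k

InjectiveOnBalanced : ℕ → (Fin m → ℤ²) → Set
InjectiveOnBalanced {m} k v = ∀ (a b : Vec ℤ m) → Balanced a → Balanced b → posSum a ≤ k → posSum b ≤ k →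
                              linComb v a ≡ linComb v b → a ≡ b

private
  k+k≡2*k : ∀ k → k ℕ.+ k ≡ 2 * k
  k+k≡2*k k = cong (k ℕ.+_) (sym (ℕP.+-identityʳ k))

-- Cut a decomposition of c into hops after the k-th hop.
balanced-split : ∀ k (c : Vec ℤ m) → Balanced c → posSum c ≤ 2 * k →
                 ∃₂ λ a b → Balanced a × Balanced b × posSum a ≤ k × posSum b ≤ k × c ≡ a -ᵛ b
balanced-split {m} k c bal height with decompose (posSum c) c bal refl
... | ps , len , _ , refl =
  a , b , balanced-coefficients xs , trans (sumℤ-neg (coefficients ys)) (cong -_ (balanced-coefficients ys)) ,
  height-a , height-b , coefficients≡a-b
  where
  xs ys : List (Fin m × Fin m)
  xs = List.take k ps
  ys = List.drop k ps
  a b : Vec ℤ m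
  a = coefficients xs
  b = -ᵛ coefficients ys
  height-a : posSum a ≤ k
  height-a = begin
    posSum a          ≤⟨ posSum-coefficients xs ⟩
    length xs         ≡⟨ ListP.length-take k ps ⟩
    k ℕ.⊓ length ps   ≤⟨ ℕP.m⊓n≤m k (length ps) ⟩
    k                 ∎
    where open ℕP.≤-Reasoning
  height-b : posSum b ≤ k
  height-b = begin
    posSum b                   ≡⟨ balanced⇒posSum≡negSum (coefficients ys) (balanced-coefficients ys) ⟨
    posSum (coefficients ys)   ≤⟨ posSum-coefficients ys ⟩
    length ys                  ≡⟨ ListP.length-drop k ps ⟩
    length ps ℕ.∸ k            ≤⟨ ℕP.∸-monoˡ-≤ k (ℕP.≤-trans (ℕP.≤-reflexive len)
                                                   (ℕP.≤-trans height (ℕP.≤-reflexive (sym (k+k≡2*k k))))) ⟩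
    (k ℕ.+ k) ℕ.∸ k            ≡⟨ ℕP.m+n∸n≡m k k ⟩
    k                          ∎
    where open ℕP.≤-Reasoning
  coefficients≡a-b : coefficients ps ≡ a -ᵛ b
  coefficients≡a-b = begin
    coefficients ps           ≡⟨ cong coefficients (ListP.take++drop≡id k ps) ⟨
    coefficients (xs ++ ys)   ≡⟨ coefficients-++ xs ys ⟩
    a +ᵛ coefficients ys      ≡⟨ cong (a +ᵛ_) (-ᵛ-involutive (coefficients ys)) ⟨
    a -ᵛ b                    ∎
    where open ≡-Reasoning

module _ {k : ℕ} (v : Fin m → ℤ²) where

  noRelation⇒injective : NoRelationUpTo (2 * k) v → InjectiveOnBalanced k v
  noRelation⇒injective noRel a b bal-a bal-b height-a height-b eq =
    difference≡0ᵛ⇒≡ a b (noRel (a -ᵛ b) bal height (linComb-difference-≡0² v eq))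
    where
    bal : Balanced (a -ᵛ b)
    bal = trans (sumℤ-difference a b) (cong₂ _-_ bal-a bal-b)
    height : posSum (a -ᵛ b) ≤ 2 * k
    height = begin
      posSum (a -ᵛ b)         ≤⟨ posSum-+ᵛ a (-ᵛ b) ⟩
      posSum a ℕ.+ negSum b   ≡⟨ cong (posSum a ℕ.+_) (balanced⇒posSum≡negSum b bal-b) ⟨
      posSum a ℕ.+ posSum b   ≤⟨ ℕP.+-mono-≤ height-a height-b ⟩
      k ℕ.+ k                 ≡⟨ k+k≡2*k k ⟩
      2 * k                   ∎
      where open ℕP.≤-Reasoning

  injective⇒noRelation : InjectiveOnBalanced k v → NoRelationUpTo (2 * k) v
  injective⇒noRelation inj c bal height lin≡0 with balanced-split k c bal height
  ... | a , b , bal-a , bal-b , height-a , height-b , refl =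
    trans (cong (_-ᵛ b) a≡b) (+ᵛ-inverseʳ b)
    where
    a≡b : a ≡ b
    a≡b = inj a b bal-a bal-b height-a height-b (begin
      linComb v a         ≡⟨ ⊕≡0²⇒≡-² (linComb v a) (-² linComb v b) (trans (sym (linComb-difference v a b)) lin≡0) ⟩
      -² -² linComb v b   ≡⟨ -²-involutive (linComb v b) ⟩
      linComb v b         ∎)
      where open ≡-Reasoning

-- The enumerations defining coverage and Hsum

∈-tuples⁻ : ∀ {A : Set} ℓ (xs : List A) {ps} → ps ∈ tuples ℓ xs → length ps ≡ ℓ
∈-tuples⁻ zero    xs (here refl) = refl
∈-tuples⁻ (suc ℓ) xs ps∈ with ∈-concat⁻′ (List.map (λ x → List.map (x ∷_) (tuples ℓ xs)) xs) ps∈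
... | _ , ps∈qss , qss∈ with ∈-map⁻ (λ x → List.map (x ∷_) (tuples ℓ xs)) qss∈
... | x , _ , refl with ∈-map⁻ (x ∷_) ps∈qss
... | qs , qs∈ , refl = cong suc (∈-tuples⁻ ℓ xs qs∈)

∈-tuples⁺ : ∀ {A : Set} (xs : List A) {ps} → All (_∈ xs) ps → ps ∈ tuples (length ps) xs
∈-tuples⁺ xs []                  = here refl
∈-tuples⁺ xs {p ∷ ps} (p∈ ∷ ps∈) =
  ∈-concat⁺′ (∈-map⁺ (p ∷_) (∈-tuples⁺ xs ps∈)) (∈-map⁺ (λ x → List.map (x ∷_) (tuples (length ps) xs)) p∈)

∈-offPairs⁺ : {α β : Fin m} → α ≢ β → (α , β) ∈ offPairs m
∈-offPairs⁺ {α = α} {β} α≢β = ∈-filter⁺ _ (∈-cartesianProduct⁺ (∈-allFin α) (∈-allFin β)) α≢β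

module _ (k : ℕ) (v : Fin m → ℤ²) where

  private
    hopsOfLength : ℕ → List ℤ²
    hopsOfLength ℓ = List.map (hopSum v) (tuples ℓ (offPairs m))

  ∈-hopVectors⁻ : ∀ {x} → x ∈ hopVectors k v → ∃ λ ps → length ps ≤ k × hopSum v ps ≡ x
  ∈-hopVectors⁻ x∈ with ∈-concat⁻′ (List.map hopsOfLength (List.upTo (suc k))) x∈
  ... | _ , x∈ℓ , ℓ∈ with ∈-map⁻ hopsOfLength ℓ∈
  ... | ℓ , ℓ<1+k , refl with ∈-map⁻ (hopSum v) x∈ℓ
  ... | ps , ps∈ , refl =
    ps , ℕP.≤-trans (ℕP.≤-reflexive (∈-tuples⁻ ℓ (offPairs m) ps∈)) (ℕP.≤-pred (∈-upTo⁻ ℓ<1+k)) , refl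

  ∈-hopVectors⁺ : ∀ ps → length ps ≤ k → All OffDiagonal ps → hopSum v ps ∈ hopVectors k v
  ∈-hopVectors⁺ ps len off =
    ∈-concat⁺′ (∈-map⁺ (hopSum v) (∈-tuples⁺ (offPairs m) (ListAll.map ∈-offPairs⁺ off)))
               (∈-map⁺ hopsOfLength (∈-upTo⁺ (s≤s len)))

∈-rangeℤ⁺ : ∀ j x → pos x ≤ j → pos (- x) ≤ j → x ∈ rangeℤ j
∈-rangeℤ⁺ j (+ t) t≤j _ =
  subst (_∈ rangeℤ j) shift (∈-map⁺ (λ n → + n - + j) (∈-upTo⁺ (s≤s (ℕP.+-monoˡ-≤ j t≤j))))
  where
  shift : + (t ℕ.+ j) - + j ≡ + t
  shift = trans (cong (_- + j) (ℤP.pos-+ t j)) (cancel (+ t) (+ j))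
    where
    cancel : ∀ (a b : ℤ) → (a + b) - b ≡ a
    cancel = solve-∀
∈-rangeℤ⁺ j -[1+ t ] _ 1+t≤j =
  subst (_∈ rangeℤ j) shift
        (∈-map⁺ (λ n → + n - + j) (∈-upTo⁺ (s≤s (ℕP.≤-trans (ℕP.m∸n≤m j (suc t)) (ℕP.m≤m+n j j)))))
  where
  n : ℕ
  n = j ℕ.∸ suc t
  shift : + n - + j ≡ -[1+ t ]
  shift = begin
    + n - + j                    ≡⟨ cong (λ i → + n - + i) (ℕP.m∸n+n≡m 1+t≤j) ⟨
    + n - + (n ℕ.+ suc t)        ≡⟨ cong (λ i → + n - i) (ℤP.pos-+ n (suc t)) ⟩
    + n - (+ n + +[1+ t ])       ≡⟨ cancel (+ n) +[1+ t ] ⟩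
    -[1+ t ]                     ∎
    where
    open ≡-Reasoning
    cancel : ∀ (a b : ℤ) → a - (a + b) ≡ - b
    cancel = solve-∀

∈-allVecs⁺ : {xs : List ℤ} {a : Vec ℤ m} → VecAll.All (_∈ xs) a → a ∈ allVecs m xs
∈-allVecs⁺                      []        = here refl
∈-allVecs⁺ {suc m} {xs} {x ∷ _} (x∈ ∷ a∈) =
  ∈-concat⁺′ (∈-map⁺ (x ∷_) (∈-allVecs⁺ a∈)) (∈-map⁺ (λ y → List.map (y ∷_) (allVecs m xs)) x∈)

entries-∈-rangeℤ : ∀ j (a : Vec ℤ m) → posSum a ≤ j → negSum a ≤ j → VecAll.All (_∈ rangeℤ j) a
entries-∈-rangeℤ j []      _ _ = []
entries-∈-rangeℤ j (x ∷ a) p n =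
  ∈-rangeℤ⁺ j x (ℕP.m+n≤o⇒m≤o (pos x) p) (ℕP.m+n≤o⇒m≤o (pos (- x)) n) ∷
  entries-∈-rangeℤ j a (ℕP.m+n≤o⇒n≤o (pos x) p) (ℕP.m+n≤o⇒n≤o (pos (- x)) n)

∈-Hlist⁺ : ∀ j {a : Vec ℤ m} → Balanced a → posSum a ≡ j → a ∈ Hlist m j
∈-Hlist⁺ j {a} bal refl = ∈-filter⁺ _
  (∈-allVecs⁺ (entries-∈-rangeℤ j a ℕP.≤-refl (ℕP.≤-reflexive (sym (balanced⇒posSum≡negSum a bal)))))
  (bal , refl)

∈-Hlist⁻ : ∀ j {a : Vec ℤ m} → a ∈ Hlist m j → Balanced a × posSum a ≡ j
∈-Hlist⁻ {m} j a∈ = proj₂ (∈-filter⁻ _ {xs = allVecs m (rangeℤ j)} a∈)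

rangeℤ-unique : ∀ j → Unique (rangeℤ j)
rangeℤ-unique j =
  UniqueP.map⁺ (λ {x} {y} eq → ℤP.+-injective (ℤ-+-cancelʳ (- + j) (+ x) (+ y) eq)) (UniqueP.upTo⁺ _)

allVecs-unique : ∀ m {xs : List ℤ} → Unique xs → Unique (allVecs m xs)
allVecs-unique zero        _   = [] ListAllPairs.∷ ListAllPairs.[]
allVecs-unique (suc m) {xs} xs! = UniqueP.concat⁺
  (ListAllP.map⁺ (ListAll.universal (λ _ → UniqueP.map⁺ VecP.∷-injectiveʳ (allVecs-unique m xs!)) xs))
  (ListAllPairsP.map⁺ (ListAllPairs.map disjoint xs!))
  where
  disjoint : ∀ {y y′} → y ≢ y′ → ∀ {a} →
             ¬ (a ∈ List.map (y ∷_) (allVecs m xs) × a ∈ List.map (y′ ∷_) (allVecs m xs))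
  disjoint y≢y′ (a∈ , a∈′) with ∈-map⁻ _ a∈ | ∈-map⁻ _ a∈′
  ... | _ , _ , refl | _ , _ , eq = y≢y′ (VecP.∷-injectiveˡ eq)

Hlist-unique : ∀ m j → Unique (Hlist m j)
Hlist-unique m j = UniqueP.filter⁺ _ (allVecs-unique m (rangeℤ-unique j))

Hs : (m k : ℕ) → List (Vec ℤ m)
Hs m k = List.concat (List.map (λ i → Hlist m (suc i)) (List.upTo k))

Hs-unique : ∀ m k → Unique (Hs m k)
Hs-unique m k = UniqueP.concat⁺
  (ListAllP.map⁺ (ListAll.universal (λ i → Hlist-unique m (suc i)) (List.upTo k)))
  (ListAllPairsP.map⁺ (ListAllPairs.map disjoint (UniqueP.upTo⁺ k)))
  where
  disjoint : ∀ {i i′} → i ≢ i′ → ∀ {a} → ¬ (a ∈ Hlist m (suc i) × a ∈ Hlist m (suc i′))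
  disjoint i≢i′ (a∈ , a∈′) =
    i≢i′ (ℕP.suc-injective (trans (sym (proj₂ (∈-Hlist⁻ _ a∈))) (proj₂ (∈-Hlist⁻ _ a∈′))))

length-Hs : ∀ m k → length (Hs m k) ≡ Hsum m k
length-Hs m k = length-concat-map (List.upTo k)
  where
  length-concat-map : (is : List ℕ) → length (List.concat (List.map (λ i → Hlist m (suc i)) is)) ≡
                                       ListAction.sum (List.map (λ i → Hcard m (suc i)) is)
  length-concat-map []       = refl
  length-concat-map (i ∷ is) =
    trans (ListP.length-++ (Hlist m (suc i))) (cong (Hcard m (suc i) ℕ.+_) (length-concat-map is))

∈-Hs⁺ : ∀ {k} {a : Vec ℤ m} → Balanced a → 0 < posSum a → posSum a ≤ k → a ∈ Hs m k
∈-Hs⁺ {m} {a = a} bal 0<height height≤k with posSum a in eq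
... | suc i = ∈-concat⁺′ (∈-Hlist⁺ (suc i) bal eq) (∈-map⁺ (λ i → Hlist m (suc i)) (∈-upTo⁺ height≤k))

∈-Hs⁻ : ∀ {k} {a : Vec ℤ m} → a ∈ Hs m k → Balanced a × 0 < posSum a × posSum a ≤ k
∈-Hs⁻ {m} {k} a∈ with ∈-concat⁻′ (List.map (λ i → Hlist m (suc i)) (List.upTo k)) a∈
... | _ , a∈H , H∈ with ∈-map⁻ (λ i → Hlist m (suc i)) H∈
... | i , i<k , refl with ∈-Hlist⁻ (suc i) a∈H
... | bal , eq = bal , ℕP.≤-trans (s≤s z≤n) (ℕP.≤-reflexive (sym eq)) , ℕP.≤-trans (ℕP.≤-reflexive eq) (∈-upTo⁻ i<k)

-- Counting the values of a map

InjectiveOn : {A B : Set} → (A → B) → List A → Set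
InjectiveOn f xs = ∀ {a b} → a ∈ xs → b ∈ xs → f a ≡ f b → a ≡ b

∈-─⁺ : {A : Set} {x w : A} {ys : List A} (p : x ∈ ys) → w ∈ ys → w ≢ x → w ∈ ys ─ p
∈-─⁺ (here refl) (here refl) w≢x = ⊥-elim (w≢x refl)
∈-─⁺ (here _)    (there w∈)  _   = w∈
∈-─⁺ (there _)   (here refl) _   = here refl
∈-─⁺ (there p)   (there w∈)  w≢x = there (∈-─⁺ p w∈ w≢x)

unique-⊆⇒length≤ : {A : Set} {xs ys : List A} → Unique xs → (∀ {x} → x ∈ xs → x ∈ ys) → length xs ≤ length ys
unique-⊆⇒length≤ {xs = []}               _                         _   = z≤n
unique-⊆⇒length≤ {xs = x ∷ xs} {ys} (x∉xs ListAllPairs.∷ xs!) xs⊆ = begin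
  suc (length xs)            ≤⟨ s≤s (unique-⊆⇒length≤ xs! xs⊆rest) ⟩
  suc (length (ys ─ x∈ys))   ≡⟨ ListP.length-removeAt′ ys _ ⟨
  length ys                  ∎
  where
  open ℕP.≤-Reasoning
  x∈ys : x ∈ ys
  x∈ys = xs⊆ (here refl)
  xs⊆rest : ∀ {w} → w ∈ xs → w ∈ ys ─ x∈ys
  xs⊆rest w∈ = ∈-─⁺ x∈ys (xs⊆ (there w∈)) (λ w≡x → ListAll.lookup x∉xs w∈ (sym w≡x))

unique-map⁺ : {A B : Set} (f : A → B) {xs : List A} → Unique xs → InjectiveOn f xs → Unique (List.map f xs)
unique-map⁺ f {[]}     _                          _   = ListAllPairs.[]
unique-map⁺ f {x ∷ xs} (x∉xs ListAllPairs.∷ xs!) inj =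
  ListAllP.map⁺ (ListAll.tabulate (λ y∈ fx≡fy → ListAll.lookup x∉xs y∈ (inj (here refl) (there y∈) fx≡fy)))
  ListAllPairs.∷ unique-map⁺ f xs! (λ a∈ b∈ → inj (there a∈) (there b∈))

module _ {A B : Set} (_≟_ : DecidableEquality A) (f : A → B) (z : B) {xs : List A} {ys : List B}
         (xs! : Unique xs) (ys! : Unique ys)
         (ys⊆ : ∀ {y} → y ∈ ys → ∃ λ x → x ∈ xs × f x ≡ y × y ≢ z)
         (⊆ys : ∀ {x} → x ∈ xs → f x ≢ z → f x ∈ ys) where

  private
    length≢ : ∀ {a} (a∈ : a ∈ xs) → (∀ {y} → y ∈ ys → y ∈ List.map f (xs ─ a∈)) → length ys ≢ length xs
    length≢ a∈ ys⊆rest eq = ℕP.<-irrefl refl (begin-strict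
      length ys                       ≤⟨ unique-⊆⇒length≤ ys! ys⊆rest ⟩
      length (List.map f (xs ─ a∈))   ≡⟨ ListP.length-map f (xs ─ a∈) ⟩
      length (xs ─ a∈)                <⟨ ℕP.≤-reflexive (sym (ListP.length-removeAt′ xs _)) ⟩
      length xs                       ≡⟨ eq ⟨
      length ys                       ∎)
      where open ℕP.≤-Reasoning

  length≡⇒injective : length ys ≡ length xs → InjectiveOn f xs × (∀ {a} → a ∈ xs → f a ≢ z)
  length≡⇒injective eq = injective , avoiding
    where
    avoiding : ∀ {a} → a ∈ xs → f a ≢ z
    avoiding {a} a∈ fa≡z = length≢ a∈ ys⊆rest eq
      where
      ys⊆rest : ∀ {y} → y ∈ ys → y ∈ List.map f (xs ─ a∈)
      ys⊆rest y∈ with ys⊆ y∈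
      ... | c , c∈ , refl , fc≢z = ∈-map⁺ f (∈-─⁺ a∈ c∈ (λ c≡a → fc≢z (trans (cong f c≡a) fa≡z)))
    injective : InjectiveOn f xs
    injective {a} {b} a∈ b∈ fa≡fb with a ≟ b
    ... | yes a≡b = a≡b
    ... | no  a≢b = ⊥-elim (length≢ b∈ ys⊆rest eq)
      where
      ys⊆rest : ∀ {y} → y ∈ ys → y ∈ List.map f (xs ─ b∈)
      ys⊆rest y∈ with ys⊆ y∈
      ... | c , c∈ , refl , _ with c ≟ b
      ...   | yes refl = subst (_∈ List.map f (xs ─ b∈)) fa≡fb (∈-map⁺ f (∈-─⁺ b∈ a∈ a≢b))
      ...   | no  c≢b  = ∈-map⁺ f (∈-─⁺ b∈ c∈ c≢b)

  injective⇒length≡ : InjectiveOn f xs → (∀ {a} → a ∈ xs → f a ≢ z) → length ys ≡ length xs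
  injective⇒length≡ injective avoiding = ℕP.≤-antisym
    (ℕP.≤-trans (unique-⊆⇒length≤ ys! ys⊆map) (ℕP.≤-reflexive (ListP.length-map f xs)))
    (ℕP.≤-trans (ℕP.≤-reflexive (sym (ListP.length-map f xs))) (unique-⊆⇒length≤ (unique-map⁺ f xs! injective) map⊆ys))
    where
    ys⊆map : ∀ {y} → y ∈ ys → y ∈ List.map f xs
    ys⊆map y∈ with ys⊆ y∈
    ... | x , x∈ , refl , _ = ∈-map⁺ f x∈
    map⊆ys : ∀ {y} → y ∈ List.map f xs → y ∈ ys
    map⊆ys y∈ with ∈-map⁻ f y∈
    ... | x , x∈ , refl = ⊆ys x∈ (avoiding x∈)

-- Maximal coverage

module _ {m : ℕ} (k : ℕ) (v : Fin m → ℤ²) where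

  private
    covered : List ℤ²
    covered = List.deduplicate _≟²_ (List.filter (λ x → ¬? (x ≟² 0²)) (hopVectors k v))

    covered⊆ : ∀ {y} → y ∈ covered → ∃ λ a → a ∈ Hs m k × linComb v a ≡ y × y ≢ 0²
    covered⊆ y∈ with ∈-filter⁻ (λ x → ¬? (x ≟² 0²)) {xs = hopVectors k v} (∈-deduplicate⁻ _≟²_ _ y∈)
    ... | y∈hops , y≢0 with ∈-hopVectors⁻ k v y∈hops
    ... | ps , len , refl =
      coefficients ps ,
      ∈-Hs⁺ (balanced-coefficients ps) (ℕP.n≢0⇒n>0 height≢0) (ℕP.≤-trans (posSum-coefficients ps) len) ,
      linComb-coefficients v ps , y≢0
      where
      height≢0 : posSum (coefficients ps) ≢ 0
      height≢0 eq = y≢0 (begin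
        hopSum v ps                  ≡⟨ linComb-coefficients v ps ⟨
        linComb v (coefficients ps)  ≡⟨ cong (linComb v) (balanced∧posSum≡0⇒≡0ᵛ _ (balanced-coefficients ps) eq) ⟩
        linComb v 0ᵛ                 ≡⟨ linComb-0ᵛ v ⟩
        0²                           ∎)
        where open ≡-Reasoning

    ⊆covered : ∀ {a} → a ∈ Hs m k → linComb v a ≢ 0² → linComb v a ∈ covered
    ⊆covered {a} a∈ lin≢0 with ∈-Hs⁻ a∈
    ... | bal , _ , height with decompose (posSum a) a bal refl
    ... | ps , len , off , refl =
      ∈-deduplicate⁺ _≟²_ (∈-filter⁺ (λ x → ¬? (x ≟² 0²))
        (subst (_∈ hopVectors k v) (sym (linComb-coefficients v ps))
               (∈-hopVectors⁺ k v ps (ℕP.≤-trans (ℕP.≤-reflexive len) height) off))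
        lin≢0)

    zero⊎∈Hs : ∀ a → Balanced a → posSum a ≤ k → a ≡ 0ᵛ ⊎ a ∈ Hs m k
    zero⊎∈Hs a bal height with posSum a ℕ.≟ 0
    ... | yes eq = inj₁ (balanced∧posSum≡0⇒≡0ᵛ a bal eq)
    ... | no  ne = inj₂ (∈-Hs⁺ bal (ℕP.n≢0⇒n>0 ne) height)

    fromHs : InjectiveOn (linComb v) (Hs m k) × (∀ {a} → a ∈ Hs m k → linComb v a ≢ 0²) → InjectiveOnBalanced k v
    fromHs (inj , avoid) a b bal-a bal-b height-a height-b eq
      with zero⊎∈Hs a bal-a height-a | zero⊎∈Hs b bal-b height-b
    ... | inj₁ refl | inj₁ refl = refl
    ... | inj₁ refl | inj₂ b∈   = ⊥-elim (avoid b∈ (trans (sym eq) (linComb-0ᵛ v)))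
    ... | inj₂ a∈   | inj₁ refl = ⊥-elim (avoid a∈ (trans eq (linComb-0ᵛ v)))
    ... | inj₂ a∈   | inj₂ b∈   = inj a∈ b∈ eq

    toHs : InjectiveOnBalanced k v → InjectiveOn (linComb v) (Hs m k)
    toHs inj a∈ b∈ with ∈-Hs⁻ {k = k} a∈ | ∈-Hs⁻ {k = k} b∈
    ... | bal-a , _ , height-a | bal-b , _ , height-b = inj _ _ bal-a bal-b height-a height-b

    avoidingHs : InjectiveOnBalanced k v → ∀ {a} → a ∈ Hs m k → linComb v a ≢ 0²
    avoidingHs inj {a} a∈ lin≡0 with ∈-Hs⁻ {k = k} a∈
    ... | bal , 0<height , height = ℕP.<⇒≢ 0<height (sym (trans (cong posSum a≡0) (posSum-0ᵛ {m})))
      where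
      a≡0 : a ≡ 0ᵛ
      a≡0 = inj a 0ᵛ bal (sumℤ-0ᵛ {m}) height (ℕP.≤-trans (ℕP.≤-reflexive (posSum-0ᵛ {m})) z≤n)
                (trans lin≡0 (sym (linComb-0ᵛ v)))

    _≟ᵛ_ : DecidableEquality (Vec ℤ m)
    _≟ᵛ_ = VecP.≡-dec ℤP._≟_

  maximalCoverage⇔injective : MaximalCoverage k v ⇔ InjectiveOnBalanced k v
  maximalCoverage⇔injective = mk⇔
    (λ maximal → fromHs (length≡⇒injective _≟ᵛ_ (linComb v) 0² (Hs-unique m k) (deduplicate-! _) covered⊆ ⊆covered
                          (trans maximal (sym (length-Hs m k)))))
    (λ inj → trans (injective⇒length≡ _≟ᵛ_ (linComb v) 0² (Hs-unique m k) (deduplicate-! _) covered⊆ ⊆covered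
                      (toHs inj) (avoidingHs inj))
                   (length-Hs m k))

theorem8 : (k m : ℕ) → 2 ≤ k → (v : Fin m → ℤ²) →
    (IsDD v × MaximalCoverage k v) ⇔ IsBh (2 * k) v
theorem8 k m 2≤k v = mk⇔
  (λ (_ , maximal) → from (Bh⇔noRelation v) (injective⇒noRelation v (to (maximalCoverage⇔injective k v) maximal)))
  (λ Bh → let noRel = to (Bh⇔noRelation v) Bh in
          multisetInjective⇒DD v (noRelation⇒multisetInjective v (noRelation-mono 2≤2*k noRel)) ,
          from (maximalCoverage⇔injective k v) (noRelation⇒injective v noRel))
  where
  open Equivalence
  2≤2*k : 2 ≤ 2 * k
  2≤2*k = ℕP.≤-trans 2≤k (ℕP.m≤m+n k (k ℕ.+ 0))
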